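{- Let $\alpha=(\alpha_1,\dots,\alpha_\ell)$ be a composition and $\lambda=(\lambda_1,\dots,\lambda_\ell)$ a partition, both of length $\ell$, and let $M_{\alpha/\lambda}$ be the $\ell\times\ell$ matrix with $(i,j)$ entry $H_{(\alpha_i-i)-(\lambda_j-j)}$ (entries regarded as formal symbols $H_d$ with integer subscript $d$). Suppose: (1) for every $k\in\{1,\dots,\ell\}$ and every set $S$ of $k$ rows of $M_{\alpha/\lambda}$, at least one row in $S$ contains at least $k$ entries with nonnegative subscript; and (2) whenever two distinct rows $i\neq j$ of $M_{\alpha/\lambda}$ are identical, no entry of these rows is $H_0$. Then $\mathfrak{S}_{\alpha/\lambda}\neq0$ in $\mathrm{NSym}$.
   Context: A composition is a finite sequence of positive integers; a partition is a weakly decreasing sequence of positive integers. $\mathrm{NSym}$ is the free associative algebra over $\mathbb{R}$ generated by noncommuting $H_1,H_2,\dots$ (no relations), with conventions $H_0=1$ and $H_a=0$ for $a<0$; the products $H_\gamma=H_{\gamma_1}\cdots H_{\gamma_m}$ over compositions $\gamma$ form a basis. The skew immaculate function is $\mathfrak{S}_{\alpha/\lambda}=\operatorname{ndet}(M_{\alpha/\lambda})=\sum_{\sigma\in S_\ell}\operatorname{sgn}(\sigma)M_{1,\sigma(1)}M_{2,\sigma(2)}\cdots M_{\ell,\sigma(\ell)}$ (Laplace expansion starting in the top row and proceeding sequentially to the bottom row). -}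

module Defs where

open import Data.Nat as ℕ using (ℕ; zero; suc)
open import Data.Integer as ℤ using (ℤ; +_; -[1+_]; _-_; 0ℤ; 1ℤ; -1ℤ)
open import Data.Integer.Properties as ℤP using ()
open import Data.Fin using (Fin; zero; suc; toℕ; punchIn)
open import Data.Fin.Subset using (Subset)
open import Data.List using (List; []; _∷_; _++_; map; concatMap; foldr)
open import Data.List.Properties using (≡-dec)
open import Data.Vec using (Vec; lookup; tabulate)
open import Data.Product using (_×_; _,_)
open import Relation.Nullary using (does)
open import Data.Bool using (if_then_else_)
open import Data.Nat.Properties as ℕP using ()
open import Data.Fin.Properties using (all?)

-- An element is represented by a formal finite ℤ-linear combination
-- of basis words H_γ, γ a composition (list of positive naturals).
-- Two representations denote the same element of NSym iff all their
-- coefficients ('coeff') agree.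

NSymExpr : Set
NSymExpr = List (ℤ × List ℕ)

one : NSymExpr
one = (1ℤ , []) ∷ []

-- the generator H_d for an integer subscript d
-- (H_0 = 1, H_d = 0 for d < 0)
H : ℤ → NSymExpr
H -[1+ _ ]    = []
H (+ zero)    = one
H (+ suc n)   = (1ℤ , suc n ∷ []) ∷ []

_⊕_ : NSymExpr → NSymExpr → NSymExpr
_⊕_ = _++_

scale : ℤ → NSymExpr → NSymExpr
scale c = map (λ { (a , w) → (c ℤ.* a , w) })

_⊗_ : NSymExpr → NSymExpr → NSymExpr
x ⊗ y = concatMap (λ { (a , v) → map (λ { (b , w) → (a ℤ.* b , v ++ w) }) y }) x

coeff : NSymExpr → List ℕ → ℤ
coeff [] γ = 0ℤ
coeff ((a , w) ∷ x) γ =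
  if does (≡-dec ℕP._≟_ w γ) then a ℤ.+ coeff x γ else coeff x γ

NonZeroNSym : NSymExpr → Set
NonZeroNSym x = Data.Product.∃ λ γ → Relation.Nullary.¬ (coeff x γ ≡ 0ℤ)
  where open import Relation.Binary.PropositionalEquality using (_≡_)

-- Matrices of subscripts: entry (i , j) is the integer d of H_d.

SubMatrix : ℕ → Set
SubMatrix n = Fin n → Fin n → ℤ

sign : ℕ → ℤ
sign zero = 1ℤ
sign (suc k) = ℤ.- sign k

allFinL : (n : ℕ) → List (Fin n)
allFinL zero = []
allFinL (suc n) = zero ∷ map suc (allFinL n)

-- This equals Σ_σ sgn(σ) M_{1σ(1)} ⋯ M_{ℓσ(ℓ)}.
ndet : (n : ℕ) → SubMatrix n → NSymExpr
ndet zero M = one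
ndet (suc n) M =
  foldr _⊕_ []
    (map (λ j → scale (sign (toℕ j))
                  (H (M zero j) ⊗ ndet n (λ r c → M (suc r) (punchIn j c))))
         (allFinL (suc n)))

open import Relation.Binary.PropositionalEquality using (_≡_)

IsComposition : {ℓ : ℕ} → Vec ℕ ℓ → Set
IsComposition {ℓ} α = (i : Fin ℓ) → 1 ℕ.≤ lookup α i

IsPartition : {ℓ : ℕ} → Vec ℕ ℓ → Set
IsPartition {ℓ} λ′ =
  ((i : Fin ℓ) → 1 ℕ.≤ lookup λ′ i) Data.Product.×
  ((i j : Fin ℓ) → toℕ i ℕ.≤ toℕ j → lookup λ′ j ℕ.≤ lookup λ′ i)

-- (i , j) entry has subscript (α_i - i) - (λ_j - j), rows/cols numbered 1..ℓ
Mskew : {ℓ : ℕ} → Vec ℕ ℓ → Vec ℕ ℓ → SubMatrix ℓ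
Mskew α λ′ i j =
  ((+ lookup α i) - (+ suc (toℕ i))) - ((+ lookup λ′ j) - (+ suc (toℕ j)))

skewImm : {ℓ : ℕ} → Vec ℕ ℓ → Vec ℕ ℓ → NSymExpr
skewImm {ℓ} α λ′ = ndet ℓ (Mskew α λ′)

nonnegCols : {ℓ : ℕ} → SubMatrix ℓ → Fin ℓ → Subset ℓ
nonnegCols M i = tabulate (λ j → does (0ℤ ℤ.≤? M i j))

{-# OPTIONS --safe #-}
-- Write a r = α_r − r and b c = λ_c − c, so that M_{α/λ} has entries H_{a r − b c} and b is
-- strictly decreasing.  Order the rows by a (ties broken by index) and let π send the rows, in
-- this order, to the columns in increasing order of b.  Hypothesis (1), a Hall-type condition,
-- makes every entry a r − b (π r) nonnegative, so the product along π is a basis element H_w.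
-- Its coefficient in the top-row Laplace expansion is ±1: every permutation σ whose product is
-- also H_w has σ 0 = π 0, and the minor inherits all hypotheses.  If row 0 has a twin, then by
-- (2) its entries are nonzero, so the first letter of w is a 0 − b (σ 0), which determines σ 0.
-- Otherwise compare the energies ∑ (a r − b (σ r))², which depend only on w: sorting σ by
-- swapping inversions never raises the energy, lowers it whenever a row without twin moves,
-- and ends at π, the unique sorted permutation.

module Submission where

open import Defs
open import Data.Nat using (ℕ; _≤_)
open import Data.Integer using (0ℤ)
open import Data.Fin using (Fin)
open import Data.Fin.Subset using (Subset; _∈_; ∣_∣)
open import Data.Vec using (Vec)
open import Data.Product using (∃; _×_)
open import Relation.Nullary using (¬_)
open import Relation.Binary.PropositionalEquality using (_≡_)

import Algebra.Properties.CommutativeMonoid.Sum as CommutativeMonoidSum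
open import Data.Bool using (Bool; true; false; if_then_else_)
open import Data.Empty using (⊥-elim)
open import Data.Fin using (zero; suc; toℕ; punchIn; punchOut)
import Data.Fin.Properties as FinP
open import Data.Fin.Permutation as Perm using (Permutation′; _⟨$⟩ʳ_; _∘ₚ_; transpose)
open import Data.Fin.Subset using (_⊆_)
open import Data.Fin.Subset.Properties using (p⊆q⇒∣p∣≤∣q∣; p⊂q⇒∣p∣<∣q∣; x∈p⇒∣p-x∣<∣p∣)
open import Data.Integer as ℤ using (ℤ; +_; -[1+_]; +0; +[1+_]; 1ℤ; _+_; _-_; _*_; -_; _<_; +<+; +≤+)
import Data.Integer.Properties as ℤP
open import Data.Integer.Tactic.RingSolver using (solve-∀)
open import Data.List using (List; []; _∷_; _++_; map; foldr)
open import Data.List.Properties using (≡-dec)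
import Data.List.Properties as ListP
import Data.Nat as ℕ
open import Data.Nat.Induction using (<-wellFounded)
import Data.Nat.Properties as ℕP
open import Data.Product using (_,_; proj₁; proj₂)
open import Data.Sum using (_⊎_; inj₁; inj₂)
open import Data.Vec using (lookup; tabulate)
import Data.Vec.Properties as VecP
open import Function using (_∘_; _⇔_; mk⇔; _on_)
open import Function.Bundles using (Injection)
open import Function.Properties.Inverse using (↔⇒↣)
open import Induction.WellFounded using (Acc; acc)
import Relation.Binary.Construct.On as On
open import Relation.Binary.Definitions using (tri<; tri≈; tri>)
open import Relation.Binary.PropositionalEquality
  using (_≢_; _≗_; refl; sym; trans; cong; cong₂; subst; subst₂; module ≡-Reasoning)
open import Relation.Nullary using (Dec; yes; no; does; ¬?)
open import Relation.Nullary.Decidable using (dec-true; dec-false; does-⇔; decidable-stable; _×-dec_)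
open import Relation.Unary using (Pred; Decidable)

open ≡-Reasoning

module ℕ∑ = CommutativeMonoidSum ℕP.+-0-commutativeMonoid
open CommutativeMonoidSum ℤP.+-0-commutativeMonoid
  using (sum; sum-syntax; sum-cong-≗; sum-remove; sum-replicate-zero; ∑-distrib-+)

*-pos : ∀ {x y} → 0ℤ < x → 0ℤ < y → 0ℤ < x * y
*-pos {+[1+ _ ]} {+[1+ _ ]} _ _ = +<+ (ℕ.s≤s ℕ.z≤n)
*-pos {+0} (+<+ ()) _
*-pos {+[1+ _ ]} {+0} _ (+<+ ())

i<j⇒0<j-i : ∀ {i j} → i < j → 0ℤ < j - i
i<j⇒0<j-i {i} {j} i<j = subst (_< j - i) (ℤP.+-inverseʳ i) (ℤP.+-monoˡ-< (- i) i<j)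

i<i+j : ∀ i {j} → 0ℤ < j → i < i + j
i<i+j i {j} 0<j = subst (_< i + j) (ℤP.+-identityʳ i) (ℤP.+-monoʳ-< i 0<j)

i≤+∣i∣ : ∀ i → i ℤ.≤ + ℤ.∣ i ∣
i≤+∣i∣ (+ _) = ℤP.≤-refl
i≤+∣i∣ -[1+ _ ] = ℤ.-≤+

i-j≡i-k⇒j≡k : ∀ {i j k} → i - j ≡ i - k → j ≡ k
i-j≡i-k⇒j≡k {i} {j} {k} eq = trans (undo i j) (trans (cong (λ x → i - x) eq) (sym (undo i k)))
  where
  undo : ∀ i j → j ≡ i - (i - j)
  undo = solve-∀

∣i∣≡1⇒i≢0 : ∀ {i} → ℤ.∣ i ∣ ≡ 1 → i ≢ 0ℤ
∣i∣≡1⇒i≢0 () refl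

-- Finite sums and counting

∑-mono-≤ : ∀ {n} {f g : Fin n → ℤ} → (∀ i → f i ℤ.≤ g i) → sum f ℤ.≤ sum g
∑-mono-≤ {ℕ.zero} _ = ℤP.≤-refl
∑-mono-≤ {ℕ.suc n} f≤g = ℤP.+-mono-≤ (f≤g zero) (∑-mono-≤ (f≤g ∘ suc))

term≤∑ : ∀ {n} (f : Fin n → ℕ) i → f i ℕ.≤ ℕ∑.sum f
term≤∑ f zero = ℕP.m≤m+n (f zero) _
term≤∑ f (suc i) = ℕP.≤-trans (term≤∑ (f ∘ suc) i) (ℕP.m≤n+m _ (f zero))

sum≢0⇒∃≢0 : ∀ {n} (f : Fin n → ℤ) → sum f ≢ 0ℤ → ∃ λ i → f i ≢ 0ℤ
sum≢0⇒∃≢0 {ℕ.zero} f ∑≢0 = ⊥-elim (∑≢0 refl)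
sum≢0⇒∃≢0 {ℕ.suc n} f ∑≢0 with f zero ℤ.≟ 0ℤ
... | no f₀≢0 = zero , f₀≢0
... | yes f₀≡0 with sum≢0⇒∃≢0 (f ∘ suc) (λ ∑≡0 → ∑≢0 (cong₂ _+_ f₀≡0 ∑≡0))
...   | i , fi≢0 = suc i , fi≢0

sum-supported₁ : ∀ {n} (f : Fin n → ℤ) (i : Fin n) → (∀ j → j ≢ i → f j ≡ 0ℤ) → sum f ≡ f i
sum-supported₁ {ℕ.suc n} f i off = begin
  sum f                             ≡⟨ sum-remove {i = i} f ⟩
  f i + sum (f ∘ punchIn i)         ≡⟨ cong (λ x → f i + x) (sum-cong-≗ (λ j → off _ (FinP.punchInᵢ≢i i j))) ⟩
  f i + sum {n} (λ _ → 0ℤ)          ≡⟨ cong (λ x → f i + x) (sum-replicate-zero n) ⟩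
  f i + 0ℤ                          ≡⟨ ℤP.+-identityʳ (f i) ⟩
  f i                               ∎

sum-supported₂ : ∀ {n} (f : Fin n → ℤ) {i i′ : Fin n} → i ≢ i′ →
  (∀ j → j ≢ i → j ≢ i′ → f j ≡ 0ℤ) → sum f ≡ f i + f i′
sum-supported₂ {ℕ.suc n} f {i} {i′} i≢i′ off = begin
  sum f                      ≡⟨ sum-remove {i = i} f ⟩
  f i + sum (f ∘ punchIn i)  ≡⟨ cong (λ x → f i + x) (sum-supported₁ (f ∘ punchIn i) k off′) ⟩
  f i + f (punchIn i k)      ≡⟨ cong (λ j → f i + f j) (FinP.punchIn-punchOut i≢i′) ⟩
  f i + f i′                 ∎
  where
  k = punchOut i≢i′
  off′ : ∀ j → j ≢ k → f (punchIn i j) ≡ 0ℤ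
  off′ j j≢k = off (punchIn i j) (FinP.punchInᵢ≢i i j)
    (λ eq → j≢k (FinP.punchIn-injective i j k (trans eq (sym (FinP.punchIn-punchOut i≢i′)))))

sum-update₂ : ∀ {n} (f g : Fin n → ℤ) {i i′ : Fin n} → i ≢ i′ →
  (∀ j → j ≢ i → j ≢ i′ → g j ≡ f j) → sum g ≡ sum f + ((g i - f i) + (g i′ - f i′))
sum-update₂ f g {i} {i′} i≢i′ agree = begin
  sum g                              ≡⟨ sum-cong-≗ (λ j → split (g j) (f j)) ⟩
  sum (λ j → f j + (g j - f j))      ≡⟨ ∑-distrib-+ f (λ j → g j - f j) ⟩
  sum f + sum (λ j → g j - f j)      ≡⟨ cong (λ x → sum f + x) (sum-supported₂ _ i≢i′ vanish) ⟩
  sum f + ((g i - f i) + (g i′ - f i′)) ∎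
  where
  split : ∀ y x → y ≡ x + (y - x)
  split = solve-∀
  vanish : ∀ j → j ≢ i → j ≢ i′ → g j - f j ≡ 0ℤ
  vanish j j≢i j≢i′ = trans (cong (_- f j) (agree j j≢i j≢i′)) (ℤP.+-inverseʳ (f j))

subsetOf : ∀ {n p} {P : Pred (Fin n) p} → Decidable P → Subset n
subsetOf P? = tabulate (λ i → does (P? i))

module _ {n p} {P : Pred (Fin n) p} (P? : Decidable P) where

  ∈-subsetOf⁺ : ∀ {i} → P i → i ∈ subsetOf P?
  ∈-subsetOf⁺ {i} Pi = VecP.lookup⇒[]= i _ (trans (VecP.lookup∘tabulate _ i) (dec-true (P? i) Pi))

  ∈-subsetOf⁻ : ∀ {i} → i ∈ subsetOf P? → P i
  ∈-subsetOf⁻ {i} i∈ with P? i | trans (sym (VecP.lookup∘tabulate _ i)) (VecP.[]=⇒lookup i∈)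
  ... | yes Pi | _ = Pi

indicator : Bool → ℕ
indicator b = if b then 1 else 0

∣tabulate∣≡∑ : ∀ {n} (f : Fin n → Bool) → ∣ tabulate f ∣ ≡ ℕ∑.sum (indicator ∘ f)
∣tabulate∣≡∑ {ℕ.zero} f = refl
∣tabulate∣≡∑ {ℕ.suc n} f with f zero
... | true = cong ℕ.suc (∣tabulate∣≡∑ (f ∘ suc))
... | false = ∣tabulate∣≡∑ (f ∘ suc)

∣subsetOf∣-permute : ∀ {n p q} {P : Pred (Fin n) p} {Q : Pred (Fin n) q}
  (P? : Decidable P) (Q? : Decidable Q) (σ : Permutation′ n) →
  (∀ r → P (σ ⟨$⟩ʳ r) ⇔ Q r) → ∣ subsetOf P? ∣ ≡ ∣ subsetOf Q? ∣
∣subsetOf∣-permute P? Q? σ P∘σ⇔Q = begin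
  ∣ subsetOf P? ∣                                     ≡⟨ ∣tabulate∣≡∑ (λ c → does (P? c)) ⟩
  ℕ∑.sum (λ c → indicator (does (P? c)))               ≡⟨ ℕ∑.sum-permute _ σ ⟩
  ℕ∑.sum (λ r → indicator (does (P? (σ ⟨$⟩ʳ r))))
    ≡⟨ ℕ∑.sum-cong-≗ (λ r → cong indicator (does-⇔ (P∘σ⇔Q r) (P? _) (Q? r))) ⟩
  ℕ∑.sum (λ r → indicator (does (Q? r)))               ≡⟨ ∣tabulate∣≡∑ (λ r → does (Q? r)) ⟨
  ∣ subsetOf Q? ∣                                     ∎

-- Coefficients in NSym

coeff-⊕ : ∀ x y γ → coeff (x ⊕ y) γ ≡ coeff x γ + coeff y γ
coeff-⊕ [] y γ = sym (ℤP.+-identityˡ _)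
coeff-⊕ ((c , w) ∷ x) y γ with does (≡-dec ℕP._≟_ w γ)
... | true = trans (cong (λ s → c + s) (coeff-⊕ x y γ)) (sym (ℤP.+-assoc c _ _))
... | false = coeff-⊕ x y γ

coeff-scale : ∀ s x γ → coeff (scale s x) γ ≡ s * coeff x γ
coeff-scale s [] γ = sym (ℤP.*-zeroʳ s)
coeff-scale s ((c , w) ∷ x) γ with does (≡-dec ℕP._≟_ w γ)
... | true = trans (cong (λ t → s * c + t) (coeff-scale s x γ)) (sym (ℤP.*-distribˡ-+ s c _))
... | false = coeff-scale s x γ

coeff-monomial-⊗ : ∀ c v X γ → coeff (((c , v) ∷ []) ⊗ X) (v ++ γ) ≡ c * coeff X γ
coeff-monomial-⊗ c v [] γ = sym (ℤP.*-zeroʳ c)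
coeff-monomial-⊗ c v ((c′ , w) ∷ X) γ
  rewrite does-⇔ (mk⇔ (ListP.++-cancelˡ v w γ) (cong (v ++_)))
                 (≡-dec ℕP._≟_ (v ++ w) (v ++ γ)) (≡-dec ℕP._≟_ w γ)
  with does (≡-dec ℕP._≟_ w γ)
... | true = trans (cong (λ t → c * c′ + t) (coeff-monomial-⊗ c v X γ)) (sym (ℤP.*-distribˡ-+ c c′ _))
... | false = coeff-monomial-⊗ c v X γ

coeff-monomial-⊗-off : ∀ c v X γ → (∀ w → v ++ w ≢ γ) → coeff (((c , v) ∷ []) ⊗ X) γ ≡ 0ℤ
coeff-monomial-⊗-off c v [] γ off = refl
coeff-monomial-⊗-off c v ((c′ , w) ∷ X) γ off
  rewrite dec-false (≡-dec ℕP._≟_ (v ++ w) γ) (off w) = coeff-monomial-⊗-off c v X γ off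

prefix? : (v γ : List ℕ) → Dec (∃ λ w → v ++ w ≡ γ)
prefix? [] γ = yes (γ , refl)
prefix? (x ∷ v) [] = no λ ()
prefix? (x ∷ v) (y ∷ γ) with x ℕP.≟ y | prefix? v γ
... | no x≢y | _ = no λ (_ , eq) → x≢y (ListP.∷-injectiveˡ eq)
... | yes refl | yes (w , refl) = yes (w , refl)
... | yes refl | no ¬prefix = no λ (w , eq) → ¬prefix (w , ListP.∷-injectiveʳ eq)

-- The basis word of H_d for d ≥ 0; the value at d < 0 (where H_d = 0) is junk.
letter : ℤ → List ℕ
letter +[1+ k ] = ℕ.suc k ∷ []
letter _ = []

H-monomial : ∀ {d} → 0ℤ ℤ.≤ d → H d ≡ (1ℤ , letter d) ∷ []
H-monomial {+0} _ = refl
H-monomial {+[1+ _ ]} _ = refl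

coeff-H-⊗ : ∀ {d} → 0ℤ ℤ.≤ d → ∀ X γ → coeff (H d ⊗ X) (letter d ++ γ) ≡ coeff X γ
coeff-H-⊗ {d} d≥0 X γ rewrite H-monomial d≥0 =
  trans (coeff-monomial-⊗ 1ℤ (letter d) X γ) (ℤP.*-identityˡ _)

coeff-H-⊗-support : ∀ d X γ → coeff (H d ⊗ X) γ ≢ 0ℤ →
  0ℤ ℤ.≤ d × ∃ λ γ′ → γ ≡ letter d ++ γ′ × coeff X γ′ ≢ 0ℤ
coeff-H-⊗-support -[1+ _ ] X γ c≢0 = ⊥-elim (c≢0 refl)
coeff-H-⊗-support (+ n) X γ c≢0 with prefix? (letter (+ n)) γ
... | yes (γ′ , refl) = +≤+ ℕ.z≤n , γ′ , refl , c≢0 ∘ trans (coeff-H-⊗ {+ n} (+≤+ ℕ.z≤n) X γ′)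
... | no ¬prefix = ⊥-elim (c≢0 (begin
  coeff (H (+ n) ⊗ X) γ
    ≡⟨ cong (λ h → coeff (h ⊗ X) γ) (H-monomial (+≤+ ℕ.z≤n)) ⟩
  coeff (((1ℤ , letter (+ n)) ∷ []) ⊗ X) γ
    ≡⟨ coeff-monomial-⊗-off 1ℤ _ X γ (λ w eq → ¬prefix (w , eq)) ⟩
  0ℤ
    ∎))

letter-injective : ∀ {x y u v} → 0ℤ < x → 0ℤ < y → letter x ++ u ≡ letter y ++ v → x ≡ y
letter-injective {+[1+ _ ]} {+[1+ _ ]} _ _ eq = cong (+_ ∘ ℕ.suc) (ℕP.suc-injective (ListP.∷-injectiveˡ eq))
letter-injective {+0} (+<+ ()) _ _
letter-injective {+[1+ _ ]} {+0} _ (+<+ ()) _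

-- Laplace expansion and the support of ndet

minor : ∀ {n} → SubMatrix (ℕ.suc n) → Fin (ℕ.suc n) → SubMatrix n
minor M j r c = M (suc r) (punchIn j c)

laplaceTerm : ∀ {n} → SubMatrix (ℕ.suc n) → List ℕ → Fin (ℕ.suc n) → ℤ
laplaceTerm {n} M γ j = sign (toℕ j) * coeff (H (M zero j) ⊗ ndet n (minor M j)) γ

coeff-foldr-⊕ : ∀ {n} (F : Fin n → NSymExpr) γ →
  coeff (foldr _⊕_ [] (map F (allFinL n))) γ ≡ ∑[ j < n ] coeff (F j) γ
coeff-foldr-⊕ {ℕ.zero} F γ = refl
coeff-foldr-⊕ {ℕ.suc n} F γ = begin
  coeff (F zero ⊕ foldr _⊕_ [] (map F (map suc (allFinL n)))) γ
    ≡⟨ coeff-⊕ (F zero) _ γ ⟩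
  coeff (F zero) γ + coeff (foldr _⊕_ [] (map F (map suc (allFinL n)))) γ
    ≡⟨ cong (λ l → coeff (F zero) γ + coeff (foldr _⊕_ [] l) γ) (ListP.map-∘ (allFinL n)) ⟨
  coeff (F zero) γ + coeff (foldr _⊕_ [] (map (F ∘ suc) (allFinL n))) γ
    ≡⟨ cong (λ s → coeff (F zero) γ + s) (coeff-foldr-⊕ (F ∘ suc) γ) ⟩
  coeff (F zero) γ + ∑[ j < n ] coeff (F (suc j)) γ
    ∎

coeff-ndet-suc : ∀ {n} (M : SubMatrix (ℕ.suc n)) γ →
  coeff (ndet (ℕ.suc n) M) γ ≡ ∑[ j < ℕ.suc n ] laplaceTerm M γ j
coeff-ndet-suc {n} M γ = trans (coeff-foldr-⊕ term γ)
  (sum-cong-≗ (λ j → coeff-scale (sign (toℕ j)) (H (M zero j) ⊗ ndet n (minor M j)) γ))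
  where
  term : Fin (ℕ.suc n) → NSymExpr
  term j = scale (sign (toℕ j)) (H (M zero j) ⊗ ndet n (minor M j))

∣sign∣≡1 : ∀ k → ℤ.∣ sign k ∣ ≡ 1
∣sign∣≡1 ℕ.zero = refl
∣sign∣≡1 (ℕ.suc k) = trans (ℤP.∣-i∣≡∣i∣ (sign k)) (∣sign∣≡1 k)

transversal : ∀ {n} → SubMatrix n → Permutation′ n → Fin n → ℤ
transversal M σ r = M r (σ ⟨$⟩ʳ r)

NonNegative : ∀ {n} → SubMatrix n → Permutation′ n → Set
NonNegative M σ = ∀ r → 0ℤ ℤ.≤ transversal M σ r

letters : ∀ {n} → (Fin n → ℤ) → List ℕ
letters {ℕ.zero} v = []
letters {ℕ.suc n} v = letter (v zero) ++ letters (v ∘ suc)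

letters-cong : ∀ {n} {v w : Fin n → ℤ} → v ≗ w → letters v ≡ letters w
letters-cong {ℕ.zero} v≗w = refl
letters-cong {ℕ.suc n} v≗w = cong₂ _++_ (cong letter (v≗w zero)) (letters-cong (v≗w ∘ suc))

word : ∀ {n} → SubMatrix n → Permutation′ n → List ℕ
word M σ = letters (transversal M σ)

module _ {n} (M : SubMatrix (ℕ.suc n)) {σ : Permutation′ (ℕ.suc n)} {σ′ : Permutation′ n}
         (split : ∀ k → σ ⟨$⟩ʳ suc k ≡ punchIn (σ ⟨$⟩ʳ zero) (σ′ ⟨$⟩ʳ k)) where

  transversal-minor : ∀ k → transversal (minor M (σ ⟨$⟩ʳ zero)) σ′ k ≡ transversal M σ (suc k)
  transversal-minor k = cong (M (suc k)) (sym (split k))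

  word-minor : word M σ ≡ letter (M zero (σ ⟨$⟩ʳ zero)) ++ word (minor M (σ ⟨$⟩ʳ zero)) σ′
  word-minor = cong (letter (M zero (σ ⟨$⟩ʳ zero)) ++_) (letters-cong (sym ∘ transversal-minor))

  nonNegative-minor : NonNegative M σ → NonNegative (minor M (σ ⟨$⟩ʳ zero)) σ′
  nonNegative-minor nonneg k = subst (0ℤ ℤ.≤_) (sym (transversal-minor k)) (nonneg (suc k))

  nonNegative-extend : 0ℤ ℤ.≤ M zero (σ ⟨$⟩ʳ zero) → NonNegative (minor M (σ ⟨$⟩ʳ zero)) σ′ →
    NonNegative M σ
  nonNegative-extend M₀≥0 nonneg′ zero = M₀≥0
  nonNegative-extend M₀≥0 nonneg′ (suc k) = subst (0ℤ ℤ.≤_) (transversal-minor k) (nonneg′ k)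

support : ∀ n (M : SubMatrix n) γ → coeff (ndet n M) γ ≢ 0ℤ →
  ∃ λ σ → NonNegative M σ × word M σ ≡ γ

laplaceTerm-support : ∀ {n} (M : SubMatrix (ℕ.suc n)) γ j → laplaceTerm M γ j ≢ 0ℤ →
  ∃ λ σ → σ ⟨$⟩ʳ zero ≡ j × NonNegative M σ × word M σ ≡ γ
laplaceTerm-support {n} M γ j t≢0
  with coeff-H-⊗-support (M zero j) (ndet n (minor M j)) γ
         (λ c≡0 → t≢0 (trans (cong (sign (toℕ j) *_) c≡0) (ℤP.*-zeroʳ (sign (toℕ j)))))
... | M₀≥0 , γ′ , refl , c≢0 with support n (minor M j) γ′ c≢0
...   | σ′ , nonneg′ , refl =
  σ , refl , nonNegative-extend M {σ} {σ′} split M₀≥0 nonneg′ , word-minor M {σ} {σ′} split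
  where
  σ : Permutation′ (ℕ.suc n)
  σ = Perm.insert zero j σ′
  split : ∀ k → σ ⟨$⟩ʳ suc k ≡ punchIn (σ ⟨$⟩ʳ zero) (σ′ ⟨$⟩ʳ k)
  split = Perm.insert-punchIn zero j σ′

support ℕ.zero M [] _ = Perm.id , (λ ()) , refl
support ℕ.zero M (_ ∷ _) c≢0 = ⊥-elim (c≢0 refl)
support (ℕ.suc n) M γ c≢0 with sum≢0⇒∃≢0 (laplaceTerm M γ) (c≢0 ∘ trans (coeff-ndet-suc M γ))
... | j , t≢0 with laplaceTerm-support M γ j t≢0
...   | σ , _ , nonneg , w≡γ = σ , nonneg , w≡γ

-- Energy and transpositions

squareSum : List ℕ → ℤ
squareSum [] = 0ℤ
squareSum (k ∷ w) = + k * + k + squareSum w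

squareSum-++ : ∀ u w → squareSum (u ++ w) ≡ squareSum u + squareSum w
squareSum-++ [] w = sym (ℤP.+-identityˡ _)
squareSum-++ (k ∷ u) w = trans (cong (λ s → + k * + k + s) (squareSum-++ u w)) (sym (ℤP.+-assoc (+ k * + k) _ _))

squareSum-letter : ∀ {d} → 0ℤ ℤ.≤ d → squareSum (letter d) ≡ d * d
squareSum-letter {+0} _ = refl
squareSum-letter {+[1+ _ ]} _ = ℤP.+-identityʳ _

squareSum-letters : ∀ {n} (v : Fin n → ℤ) → (∀ r → 0ℤ ℤ.≤ v r) →
  ∑[ r < n ] (v r * v r) ≡ squareSum (letters v)
squareSum-letters {ℕ.zero} v _ = refl
squareSum-letters {ℕ.suc n} v v≥0 = begin
  v zero * v zero + ∑[ r < n ] (v (suc r) * v (suc r))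
    ≡⟨ cong₂ _+_ (sym (squareSum-letter (v≥0 zero))) (squareSum-letters (v ∘ suc) (v≥0 ∘ suc)) ⟩
  squareSum (letter (v zero)) + squareSum (letters (v ∘ suc))
    ≡⟨ squareSum-++ (letter (v zero)) _ ⟨
  squareSum (letters v)
    ∎

cost : ∀ {n} → (Fin n → Fin n → ℤ) → Permutation′ n → ℤ
cost {n} h σ = ∑[ r < n ] h r (σ ⟨$⟩ʳ r)

cost-cong : ∀ {n} (h : Fin n → Fin n → ℤ) (σ τ : Permutation′ n) → (∀ r → σ ⟨$⟩ʳ r ≡ τ ⟨$⟩ʳ r) →
  cost h σ ≡ cost h τ
cost-cong h σ τ σ≗τ = sum-cong-≗ (λ r → cong (h r) (σ≗τ r))

energy-word : ∀ {n} (M : SubMatrix n) σ → NonNegative M σ →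
  cost (λ r c → M r c * M r c) σ ≡ squareSum (word M σ)
energy-word M σ = squareSum-letters (transversal M σ)

swap : ∀ {n} → Fin n → Fin n → Permutation′ n → Permutation′ n
swap r r′ σ = transpose r r′ ∘ₚ σ

module _ {n} {r r′ : Fin n} (σ : Permutation′ n) where

  swap-applyˡ : swap r r′ σ ⟨$⟩ʳ r ≡ σ ⟨$⟩ʳ r′
  swap-applyˡ rewrite dec-true (r FinP.≟ r) refl = refl

  swap-applyʳ : swap r r′ σ ⟨$⟩ʳ r′ ≡ σ ⟨$⟩ʳ r
  swap-applyʳ with r′ FinP.≟ r
  ... | yes refl = refl
  ... | no r′≢r rewrite dec-true (r′ FinP.≟ r′) refl = refl

  swap-apply-other : ∀ {x} → x ≢ r → x ≢ r′ → swap r r′ σ ⟨$⟩ʳ x ≡ σ ⟨$⟩ʳ x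
  swap-apply-other {x} x≢r x≢r′ rewrite dec-false (x FinP.≟ r) x≢r | dec-false (x FinP.≟ r′) x≢r′ = refl

  cost-swap : ∀ h → r ≢ r′ → cost h (swap r r′ σ) ≡
    cost h σ + ((h r (σ ⟨$⟩ʳ r′) - h r (σ ⟨$⟩ʳ r)) + (h r′ (σ ⟨$⟩ʳ r) - h r′ (σ ⟨$⟩ʳ r′)))
  cost-swap h r≢r′ =
    trans (sum-update₂ (λ x → h x (σ ⟨$⟩ʳ x)) (λ x → h x (swap r r′ σ ⟨$⟩ʳ x)) r≢r′
             (λ x x≢r x≢r′ → cong (h x) (swap-apply-other x≢r x≢r′)))
          (cong₂ (λ c c′ → cost h σ + ((h r c - h r (σ ⟨$⟩ʳ r)) + (h r′ c′ - h r′ (σ ⟨$⟩ʳ r′))))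
                 swap-applyˡ swap-applyʳ)

-- Sorting a transversal

Sorted : ∀ {n} → (Fin n → ℤ) → (Fin n → ℤ) → Permutation′ n → Set
Sorted K b σ = ∀ {r r′} → K r < K r′ → b (σ ⟨$⟩ʳ r) < b (σ ⟨$⟩ʳ r′)

diffMatrix : ∀ {n} → (Fin n → ℤ) → (Fin n → ℤ) → SubMatrix n
diffMatrix a b r c = a r - b c

-- K totally orders the rows, refining the order given by a.
record Admissible {n} (a b K : Fin n → ℤ) : Set where
  field
    b-injective : ∀ {c c′} → b c ≡ b c′ → c ≡ c′
    K-injective : ∀ {r r′} → K r ≡ K r′ → r ≡ r′
    K-ordered : ∀ {r r′} → K r < K r′ → a r ℤ.≤ a r′
    twin-rows-nonzero : ∀ {r r′} → r ≢ r′ → a r ≡ a r′ → ∀ c → a r - b c ≢ 0ℤ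

  K-≤⇒a-≤ : ∀ {r r′} → K r ℤ.≤ K r′ → a r ℤ.≤ a r′
  K-≤⇒a-≤ {r} {r′} K≤ with K r ℤ.≟ K r′
  ... | yes K≡ = ℤP.≤-reflexive (cong a (K-injective K≡))
  ... | no K≢ = K-ordered (ℤP.≤∧≢⇒< K≤ K≢)

HallCondition : ∀ {n} → SubMatrix n → Set
HallCondition {n} M = (S : Subset n) → 1 ≤ ∣ S ∣ → ∃ λ i → i ∈ S × ∣ S ∣ ≤ ∣ nonnegCols M i ∣

module Sorting {n} {a b K : Fin n → ℤ} (adm : Admissible a b K) where
  open Admissible adm

  M : SubMatrix n
  M = diffMatrix a b

  energy : Permutation′ n → ℤ
  energy = cost (λ r c → M r c * M r c)

  potential : Permutation′ n → ℤ
  potential = cost (λ r c → K r * b c)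

  Twinless : Fin n → Set
  Twinless z = ∀ {r} → r ≢ z → a r ≢ a z

  infix 4 _≼_
  data _≼_ (τ σ : Permutation′ n) : Set where
    energy-drops : energy τ < energy σ → τ ≼ σ
    twinless-fixed : energy τ ≡ energy σ → (∀ {z} → Twinless z → τ ⟨$⟩ʳ z ≡ σ ⟨$⟩ʳ z) → τ ≼ σ

  ≼-refl : ∀ {σ} → σ ≼ σ
  ≼-refl = twinless-fixed refl (λ _ → refl)

  ≼-trans : ∀ {ρ τ σ} → ρ ≼ τ → τ ≼ σ → ρ ≼ σ
  ≼-trans (energy-drops ρ<τ) (energy-drops τ<σ) = energy-drops (ℤP.<-trans ρ<τ τ<σ)
  ≼-trans {ρ} (energy-drops ρ<τ) (twinless-fixed τ≡σ _) = energy-drops (subst (energy ρ <_) τ≡σ ρ<τ)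
  ≼-trans {σ = σ} (twinless-fixed ρ≡τ _) (energy-drops τ<σ) =
    energy-drops (subst (_< energy σ) (sym ρ≡τ) τ<σ)
  ≼-trans (twinless-fixed ρ≡τ ρ≗τ) (twinless-fixed τ≡σ τ≗σ) =
    twinless-fixed (trans ρ≡τ τ≡σ) (λ tl → trans (ρ≗τ tl) (τ≗σ tl))

  module _ (σ : Permutation′ n) {r r′ : Fin n}
           (K< : K r < K r′) (b> : b (σ ⟨$⟩ʳ r′) < b (σ ⟨$⟩ʳ r)) where
    private
      p q : ℤ
      p = b (σ ⟨$⟩ʳ r)
      q = b (σ ⟨$⟩ʳ r′)

      r≢r′ : r ≢ r′
      r≢r′ refl = ℤP.<-irrefl refl K<

    potential-swap : potential σ < potential (swap r r′ σ)
    potential-swap =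
      subst (potential σ <_) (sym potential-eq) (i<i+j (potential σ) (*-pos (i<j⇒0<j-i K<) (i<j⇒0<j-i b>)))
      where
      exchange : ∀ Φ k k′ p q → Φ + ((k * q - k * p) + (k′ * p - k′ * q)) ≡ Φ + (k′ - k) * (p - q)
      exchange = solve-∀
      potential-eq : potential (swap r r′ σ) ≡ potential σ + (K r′ - K r) * (p - q)
      potential-eq = trans (cost-swap σ (λ x c → K x * b c) r≢r′) (exchange (potential σ) (K r) (K r′) p q)

    energy-swap : energy σ ≡ energy (swap r r′ σ) + + 2 * ((a r′ - a r) * (p - q))
    energy-swap = trans (exchange (energy σ) (a r) (a r′) p q)
      (cong (_+ + 2 * ((a r′ - a r) * (p - q))) (sym (cost-swap σ (λ x c → M x c * M x c) r≢r′)))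
      where
      exchange : ∀ e x x′ p q → e ≡
        (e + (((x - q) * (x - q) - (x - p) * (x - p)) + ((x′ - p) * (x′ - p) - (x′ - q) * (x′ - q))))
          + + 2 * ((x′ - x) * (p - q))
      exchange = solve-∀

    swap-≼ : swap r r′ σ ≼ σ
    swap-≼ with a r ℤ.≟ a r′
    ... | no a≢ = energy-drops (subst (energy (swap r r′ σ) <_) (sym energy-swap)
                    (i<i+j (energy (swap r r′ σ)) (*-pos {+ 2} (+<+ (ℕ.s≤s ℕ.z≤n))
                      (*-pos a<a′ (i<j⇒0<j-i b>)))))
      where
      a<a′ : 0ℤ < a r′ - a r
      a<a′ = i<j⇒0<j-i (ℤP.≤∧≢⇒< (K-ordered K<) a≢)
    ... | yes a≡ = twinless-fixed (sym energy-unchanged) fixes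
      where
      vanish : ∀ e x p q → e + + 2 * ((x - x) * (p - q)) ≡ e
      vanish = solve-∀
      energy-unchanged : energy σ ≡ energy (swap r r′ σ)
      energy-unchanged = trans energy-swap
        (trans (cong (λ x → energy (swap r r′ σ) + + 2 * ((a r′ - x) * (p - q))) a≡) (vanish _ (a r′) p q))
      fixes : ∀ {z} → Twinless z → swap r r′ σ ⟨$⟩ʳ z ≡ σ ⟨$⟩ʳ z
      fixes tl = swap-apply-other σ (λ { refl → tl (r≢r′ ∘ sym) (sym a≡) }) (λ { refl → tl r≢r′ a≡ })

  sorted-or-inversion : ∀ σ →
    Sorted K b σ ⊎ ∃ λ r → ∃ λ r′ → K r < K r′ × b (σ ⟨$⟩ʳ r′) < b (σ ⟨$⟩ʳ r)
  sorted-or-inversion σ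
    with FinP.any? (λ r → FinP.any? (λ r′ → (K r ℤ.<? K r′) ×-dec (b (σ ⟨$⟩ʳ r′) ℤ.<? b (σ ⟨$⟩ʳ r))))
  ... | yes inversion = inj₂ inversion
  ... | no no-inversion = inj₁ sorted
    where
    sorted : Sorted K b σ
    sorted {r} {r′} K< with ℤP.<-cmp (b (σ ⟨$⟩ʳ r)) (b (σ ⟨$⟩ʳ r′))
    ... | tri< b< _ _ = b<
    ... | tri≈ _ b≡ _ = ⊥-elim (ℤP.<-irrefl (cong K (Injection.injective (↔⇒↣ σ) (b-injective b≡))) K<)
    ... | tri> _ _ b> = ⊥-elim (no-inversion (r , r′ , K< , b>))

  potentialBound : ℤ
  potentialBound = ∑[ r < n ] (+ (ℤ.∣ K r ∣ ℕ.* ℕ∑.sum (λ c → ℤ.∣ b c ∣)))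

  potential≤bound : ∀ σ → potential σ ℤ.≤ potentialBound
  potential≤bound σ = ∑-mono-≤ λ r → ℤP.≤-trans (i≤+∣i∣ (K r * b (σ ⟨$⟩ʳ r)))
    (subst (λ m → + m ℤ.≤ _) (sym (ℤP.abs-* (K r) (b (σ ⟨$⟩ʳ r))))
      (+≤+ (ℕP.*-monoʳ-≤ ℤ.∣ K r ∣ (term≤∑ (λ c → ℤ.∣ b c ∣) (σ ⟨$⟩ʳ r)))))

  slack : Permutation′ n → ℕ
  slack σ = ℤ.∣ potentialBound - potential σ ∣

  slack-decreasing : ∀ {σ τ} → potential σ < potential τ → slack τ ℕ.< slack σ
  slack-decreasing {σ} {τ} Φσ<Φτ =
    abs-< (ℤP.i≤j⇒0≤j-i (potential≤bound τ)) (ℤP.+-monoʳ-< potentialBound (ℤP.neg-mono-< Φσ<Φτ))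
    where
    abs-< : ∀ {u v} → 0ℤ ℤ.≤ u → u < v → ℤ.∣ u ∣ ℕ.< ℤ.∣ v ∣
    abs-< (+≤+ _) (+<+ u<v) = u<v

  sort : ∀ σ → ∃ λ τ → Sorted K b τ × τ ≼ σ
  sort σ = go σ (On.wellFounded slack <-wellFounded σ)
    where
    go : ∀ σ → Acc (ℕ._<_ on slack) σ → ∃ λ τ → Sorted K b τ × τ ≼ σ
    go σ (acc more) with sorted-or-inversion σ
    ... | inj₁ sorted = σ , sorted , ≼-refl
    ... | inj₂ (r , r′ , K< , b>)
      with go (swap r r′ σ) (more (slack-decreasing {σ} {swap r r′ σ} (potential-swap σ K< b>)))
    ...   | τ , sorted , τ≼ = τ , sorted , ≼-trans τ≼ (swap-≼ σ K< b>)

  colsUpTo : ℤ → Subset n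
  colsUpTo x = subsetOf (λ c → b c ℤ.≤? x)

  rowsUpTo : Fin n → Subset n
  rowsUpTo r = subsetOf (λ r′ → K r′ ℤ.≤? K r)

  ∈-colsUpTo⁺ : ∀ {x c} → b c ℤ.≤ x → c ∈ colsUpTo x
  ∈-colsUpTo⁺ {x} = ∈-subsetOf⁺ (λ c → b c ℤ.≤? x)

  ∈-colsUpTo⁻ : ∀ {x c} → c ∈ colsUpTo x → b c ℤ.≤ x
  ∈-colsUpTo⁻ {x} = ∈-subsetOf⁻ (λ c → b c ℤ.≤? x)

  ∣colsUpTo∣-< : ∀ {x c} → x < b c → ∣ colsUpTo x ∣ ℕ.< ∣ colsUpTo (b c) ∣
  ∣colsUpTo∣-< {x} {c} x<bc =
    p⊂q⇒∣p∣<∣q∣ (included , c , ∈-colsUpTo⁺ ℤP.≤-refl , ℤP.<⇒≱ x<bc ∘ ∈-colsUpTo⁻)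
    where
    included : colsUpTo x ⊆ colsUpTo (b c)
    included c′∈ = ∈-colsUpTo⁺ (ℤP.≤-trans (∈-colsUpTo⁻ c′∈) (ℤP.<⇒≤ x<bc))

  sorted-≤ : ∀ σ → Sorted K b σ → ∀ r r′ → b (σ ⟨$⟩ʳ r′) ℤ.≤ b (σ ⟨$⟩ʳ r) ⇔ K r′ ℤ.≤ K r
  sorted-≤ σ sorted r r′ = mk⇔ (λ b≤ → ℤP.≮⇒≥ (λ K< → ℤP.<⇒≱ (sorted K<) b≤)) from
    where
    from : K r′ ℤ.≤ K r → b (σ ⟨$⟩ʳ r′) ℤ.≤ b (σ ⟨$⟩ʳ r)
    from K≤ with K r′ ℤ.≟ K r
    ... | yes K≡ = ℤP.≤-reflexive (cong (λ x → b (σ ⟨$⟩ʳ x)) (K-injective K≡))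
    ... | no K≢ = ℤP.<⇒≤ (sorted (ℤP.≤∧≢⇒< K≤ K≢))

  rank-sorted : ∀ σ → Sorted K b σ → ∀ r → ∣ colsUpTo (b (σ ⟨$⟩ʳ r)) ∣ ≡ ∣ rowsUpTo r ∣
  rank-sorted σ sorted r =
    ∣subsetOf∣-permute (λ c → b c ℤ.≤? b (σ ⟨$⟩ʳ r)) (λ r′ → K r′ ℤ.≤? K r) σ (sorted-≤ σ sorted r)

  sorted-unique : ∀ σ τ → Sorted K b σ → Sorted K b τ → ∀ r → σ ⟨$⟩ʳ r ≡ τ ⟨$⟩ʳ r
  sorted-unique σ τ sσ sτ r with ℤP.<-cmp (b (σ ⟨$⟩ʳ r)) (b (τ ⟨$⟩ʳ r))
  ... | tri≈ _ b≡ _ = b-injective b≡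
  ... | tri< b< _ _ =
    ⊥-elim (ℕP.<-irrefl (trans (rank-sorted σ sσ r) (sym (rank-sorted τ sτ r))) (∣colsUpTo∣-< b<))
  ... | tri> _ _ b> =
    ⊥-elim (ℕP.<-irrefl (trans (rank-sorted τ sτ r) (sym (rank-sorted σ sσ r))) (∣colsUpTo∣-< b>))

  sorted-nonNegative : HallCondition M → ∀ π → Sorted K b π → NonNegative M π
  sorted-nonNegative hall π sorted r = ℤP.i≤j⇒0≤j-i (ℤP.≮⇒≥ overfull)
    where
    r∈S : r ∈ rowsUpTo r
    r∈S = ∈-subsetOf⁺ (λ r′ → K r′ ℤ.≤? K r) ℤP.≤-refl

    -- π maps the rows up to r onto colsUpTo (b (π r)), which (1) shows too small if a r < b (π r).
    overfull : ¬ (a r < b (π ⟨$⟩ʳ r))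
    overfull ar<b with hall (rowsUpTo r) (ℕP.≤-trans (ℕ.s≤s ℕ.z≤n) (x∈p⇒∣p-x∣<∣p∣ r∈S))
    ... | i , i∈S , S≤ = ℕP.<-irrefl (sym (rank-sorted π sorted r))
                           (ℕP.≤-<-trans (ℕP.≤-trans S≤ (p⊆q⇒∣p∣≤∣q∣ nonneg⊆)) (∣colsUpTo∣-< ai<b))
      where
      ai<b : a i < b (π ⟨$⟩ʳ r)
      ai<b = ℤP.≤-<-trans (K-≤⇒a-≤ (∈-subsetOf⁻ (λ r′ → K r′ ℤ.≤? K r) i∈S)) ar<b
      nonneg⊆ : nonnegCols M i ⊆ colsUpTo (a i)
      nonneg⊆ c∈ = ∈-colsUpTo⁺ (ℤP.0≤i-j⇒j≤i (∈-subsetOf⁻ (λ c → 0ℤ ℤ.≤? M i c) c∈))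

  energy-agrees : ∀ π σ τ → Sorted K b π → NonNegative M π → NonNegative M σ → word M σ ≡ word M π →
    Sorted K b τ → energy τ ≡ energy σ
  energy-agrees π σ τ sπ nπ nσ w≡ sτ = begin
    energy τ             ≡⟨ cost-cong (λ r c → M r c * M r c) τ π (sorted-unique τ π sτ sπ) ⟩
    energy π             ≡⟨ energy-word M π nπ ⟩
    squareSum (word M π) ≡⟨ cong squareSum w≡ ⟨
    squareSum (word M σ) ≡⟨ energy-word M σ nσ ⟨
    energy σ             ∎

  twinless-determined : ∀ π σ → Sorted K b π → NonNegative M π → NonNegative M σ → word M σ ≡ word M π →
    ∀ {z} → Twinless z → σ ⟨$⟩ʳ z ≡ π ⟨$⟩ʳ z
  twinless-determined π σ sπ nπ nσ w≡ {z} twinless with sort σ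
  ... | τ , sτ , energy-drops τ<σ = ⊥-elim (ℤP.<-irrefl (energy-agrees π σ τ sπ nπ nσ w≡ sτ) τ<σ)
  ... | τ , sτ , twinless-fixed _ τ≗σ = trans (sym (τ≗σ twinless)) (sorted-unique τ π sτ sπ z)

  sorted-permutation : ∃ λ π → Sorted K b π
  sorted-permutation = let π , sorted , _ = sort Perm.id in π , sorted

-- The coefficient of the sorted word

first-column-determined : ∀ {n} {a b K : Fin (ℕ.suc n) → ℤ} → Admissible a b K → ∀ π σ →
  Sorted K b π → NonNegative (diffMatrix a b) π → NonNegative (diffMatrix a b) σ →
  word (diffMatrix a b) σ ≡ word (diffMatrix a b) π → σ ⟨$⟩ʳ zero ≡ π ⟨$⟩ʳ zero
first-column-determined {a = a} {b} adm π σ sπ nπ nσ w≡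
  with FinP.any? (λ r → ¬? (r FinP.≟ zero) ×-dec (a r ℤ.≟ a zero))
... | no no-twin = Sorting.twinless-determined adm π σ sπ nπ nσ w≡ (λ r≢0 twin → no-twin (_ , r≢0 , twin))
... | yes (r , r≢0 , twin) =
  b-injective (i-j≡i-k⇒j≡k {a zero} (letter-injective (positive σ nσ) (positive π nπ) first-letters))
  where
  open Admissible adm
  -- Row 0 has no zero entry, so its entry is the first letter of the word.
  first-letters : letter (a zero - b (σ ⟨$⟩ʳ zero)) ++ letters (transversal (diffMatrix a b) σ ∘ suc)
                ≡ letter (a zero - b (π ⟨$⟩ʳ zero)) ++ letters (transversal (diffMatrix a b) π ∘ suc)
  first-letters = w≡
  positive : ∀ τ → NonNegative (diffMatrix a b) τ → 0ℤ < a zero - b (τ ⟨$⟩ʳ zero)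
  positive τ nonneg = ℤP.≤∧≢⇒< (nonneg zero) (twin-rows-nonzero (r≢0 ∘ sym) (sym twin) _ ∘ sym)

admissible-minor : ∀ {n} {a b K : Fin (ℕ.suc n) → ℤ} → Admissible a b K → ∀ j →
  Admissible (a ∘ suc) (b ∘ punchIn j) (K ∘ suc)
admissible-minor adm j = record
  { b-injective = FinP.punchIn-injective j _ _ ∘ b-injective
  ; K-injective = FinP.suc-injective ∘ K-injective
  ; K-ordered = K-ordered
  ; twin-rows-nonzero = λ r≢r′ twin c → twin-rows-nonzero (r≢r′ ∘ FinP.suc-injective) twin (punchIn j c)
  }
  where open Admissible adm

sorted-minor : ∀ {n} {K b : Fin (ℕ.suc n) → ℤ} π → Sorted K b π →
  Sorted (K ∘ suc) (b ∘ punchIn (π ⟨$⟩ʳ zero)) (Perm.remove zero π)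
sorted-minor {b = b} π sorted {r} {r′} K< =
  subst₂ _<_ (cong b (Perm.punchIn-permute π zero r)) (cong b (Perm.punchIn-permute π zero r′)) (sorted K<)

coeff-sorted-word : ∀ n {a b K : Fin n → ℤ} → Admissible a b K →
  ∀ π → Sorted K b π → NonNegative (diffMatrix a b) π →
  ℤ.∣ coeff (ndet n (diffMatrix a b)) (word (diffMatrix a b) π) ∣ ≡ 1
coeff-sorted-word ℕ.zero _ _ _ _ = refl
coeff-sorted-word (ℕ.suc n) {a} {b} {K} adm π sorted nonneg = begin
  ℤ.∣ coeff (ndet (ℕ.suc n) M) w ∣
    ≡⟨ cong ℤ.∣_∣ (trans (coeff-ndet-suc M w) (sum-supported₁ (laplaceTerm M w) j other-terms-vanish)) ⟩
  ℤ.∣ sign (toℕ j) * coeff (H (M zero j) ⊗ ndet n (minor M j)) w ∣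
    ≡⟨ cong (λ γ → ℤ.∣ sign (toℕ j) * coeff (H (M zero j) ⊗ ndet n (minor M j)) γ ∣)
            (word-minor M {π} {π′} split) ⟩
  ℤ.∣ sign (toℕ j) * coeff (H (M zero j) ⊗ ndet n (minor M j)) (letter (M zero j) ++ w′) ∣
    ≡⟨ cong (λ c → ℤ.∣ sign (toℕ j) * c ∣) (coeff-H-⊗ (nonneg zero) (ndet n (minor M j)) w′) ⟩
  ℤ.∣ sign (toℕ j) * coeff (ndet n (minor M j)) w′ ∣
    ≡⟨ ℤP.abs-* (sign (toℕ j)) _ ⟩
  ℤ.∣ sign (toℕ j) ∣ ℕ.* ℤ.∣ coeff (ndet n (minor M j)) w′ ∣
    ≡⟨ cong₂ ℕ._*_ (∣sign∣≡1 (toℕ j))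
             (coeff-sorted-word n (admissible-minor adm j) π′ (sorted-minor {K = K} {b} π sorted)
                                (nonNegative-minor M {π} {π′} split nonneg)) ⟩
  1 ∎
  where
  M : SubMatrix (ℕ.suc n)
  M = diffMatrix a b
  j : Fin (ℕ.suc n)
  j = π ⟨$⟩ʳ zero
  π′ : Permutation′ n
  π′ = Perm.remove zero π
  split : ∀ k → π ⟨$⟩ʳ suc k ≡ punchIn j (π′ ⟨$⟩ʳ k)
  split = Perm.punchIn-permute π zero
  w w′ : List ℕ
  w = word M π
  w′ = word (minor M j) π′
  other-terms-vanish : ∀ j′ → j′ ≢ j → laplaceTerm M w j′ ≡ 0ℤ
  other-terms-vanish j′ j′≢j = decidable-stable (laplaceTerm M w j′ ℤ.≟ 0ℤ) λ t≢0 →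
    let σ , σ₀≡j′ , nσ , wσ = laplaceTerm-support M w j′ t≢0
    in j′≢j (trans (sym σ₀≡j′) (first-column-determined adm π σ sorted nonneg nσ wσ))

-- The skew matrix M_{α/λ}

offset : ∀ {ℓ} → Vec ℕ ℓ → Fin ℓ → ℤ
offset v i = + lookup v i - + ℕ.suc (toℕ i)

module _ {ℓ} (λ′ : Vec ℕ ℓ) (isP : IsPartition λ′) where

  offset-decreasing : ∀ {c c′} → toℕ c ℕ.< toℕ c′ → offset λ′ c′ < offset λ′ c
  offset-decreasing {c} {c′} c<c′ =
    ℤP.+-mono-≤-< (+≤+ (proj₂ isP c c′ (ℕP.<⇒≤ c<c′))) (ℤP.neg-mono-< (+<+ (ℕ.s≤s c<c′)))

  offset-injective : ∀ {c c′} → offset λ′ c ≡ offset λ′ c′ → c ≡ c′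
  offset-injective {c} {c′} eq with ℕP.<-cmp (toℕ c) (toℕ c′)
  ... | tri< c<c′ _ _ = ⊥-elim (ℤP.<-irrefl (sym eq) (offset-decreasing c<c′))
  ... | tri≈ _ c≡c′ _ = FinP.toℕ-injective c≡c′
  ... | tri> _ _ c>c′ = ⊥-elim (ℤP.<-irrefl eq (offset-decreasing c>c′))

-- The lexicographic order on (a r , r), encoded in ℤ using 0 ≤ toℕ r < ℓ.
key : ∀ {ℓ} → (Fin ℓ → ℤ) → Fin ℓ → ℤ
key {ℓ} a r = a r * + ℓ + + toℕ r

module _ {ℓ} (a : Fin ℓ → ℤ) where

  key-mono : ∀ {r r′} → a r < a r′ → key a r < key a r′
  key-mono {r} {r′} a< = ℤP.<-≤-trans (ℤP.+-monoʳ-< (a r * + ℓ) (+<+ (FinP.toℕ<n r)))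
    (subst (ℤ._≤ key a r′) (next-multiple (a r) (+ ℓ))
      (ℤP.≤-trans (ℤP.*-monoʳ-≤-nonNeg (+ ℓ) (ℤP.i<j⇒suc[i]≤j a<)) (ℤP.i≤i+j (a r′ * + ℓ) (+ toℕ r′))))
    where
    next-multiple : ∀ x l → (1ℤ + x) * l ≡ x * l + l
    next-multiple = solve-∀

  key-injective : ∀ {r r′} → key a r ≡ key a r′ → r ≡ r′
  key-injective {r} {r′} eq with ℤP.<-cmp (a r) (a r′)
  ... | tri< a< _ _ = ⊥-elim (ℤP.<-irrefl eq (key-mono a<))
  ... | tri> _ _ a> = ⊥-elim (ℤP.<-irrefl (sym eq) (key-mono a>))
  ... | tri≈ _ a≡ _ = FinP.toℕ-injective (ℤP.+-injective (begin
    + toℕ r                  ≡⟨ remainder (a r) (+ ℓ) (+ toℕ r) ⟩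
    key a r - a r * + ℓ      ≡⟨ cong₂ (λ k x → k - x * + ℓ) eq a≡ ⟩
    key a r′ - a r′ * + ℓ    ≡⟨ remainder (a r′) (+ ℓ) (+ toℕ r′) ⟨
    + toℕ r′                 ∎))
    where
    remainder : ∀ x l t → t ≡ (x * l + t) - x * l
    remainder = solve-∀

  key-ordered : ∀ {r r′} → key a r < key a r′ → a r ℤ.≤ a r′
  key-ordered K< = ℤP.≮⇒≥ (λ a> → ℤP.<-asym K< (key-mono a>))

theorem6 : (ℓ : ℕ) (α λ′ : Vec ℕ ℓ) →
    IsComposition α → IsPartition λ′ →
    ((S : Subset ℓ) → 1 ≤ ∣ S ∣ →
      ∃ λ i → (i ∈ S) × (∣ S ∣ ≤ ∣ nonnegCols (Mskew α λ′) i ∣)) →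
    ((i j : Fin ℓ) → ¬ (i ≡ j) → ((c : Fin ℓ) → Mskew α λ′ i c ≡ Mskew α λ′ j c) →
      (c : Fin ℓ) → ¬ (Mskew α λ′ i c ≡ 0ℤ)) →
    NonZeroNSym (skewImm α λ′)
theorem6 ℓ α λ′ _ isP hall twins = word M π , ∣i∣≡1⇒i≢0 (coeff-sorted-word ℓ adm π sorted nonneg)
  where
  M : SubMatrix ℓ
  M = diffMatrix (offset α) (offset λ′)
  adm : Admissible (offset α) (offset λ′) (key (offset α))
  adm = record
    { b-injective = offset-injective λ′ isP
    ; K-injective = key-injective (offset α)
    ; K-ordered = key-ordered (offset α)
    ; twin-rows-nonzero = λ r≢r′ same → twins _ _ r≢r′ (λ c → cong (_- offset λ′ c) same)
    }
  open Sorting adm using (sorted-permutation; sorted-nonNegative)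
  π : Permutation′ ℓ
  π = proj₁ sorted-permutation
  sorted : Sorted (key (offset α)) (offset λ′) π
  sorted = proj₂ sorted-permutation
  nonneg : NonNegative M π
  nonneg = sorted-nonNegative hall π sorted
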